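{- Let $k\geq 3$ be an integer, $v=4k+1$, $\Gamma=\mathbb{Z}_k\times\mathbb{Z}_4$, and let $\infty\notin\Gamma$. Let $\mathcal{C}=\{F_1,F_2\}$, where each $F_i$ ($i=1,2$) is a graph with vertices in $\Gamma\cup\{\infty\}$ which is a vertex-disjoint union of four cycles of length $k$, such that: (i) $V(F_i)=(\Gamma\cup\{\infty\})\setminus\{(a_i,b_i)\}$ for some $(a_i,b_i)\in \mathbb{Z}_k\times\mathbb{Z}_4$, $i=1,2$; (ii) $\infty$ has a neighbor in $\mathbb{Z}_k\times\{j\}$ for each $j\in\mathbb{Z}_4$; (iii) $\Delta_{(p,p)}\mathcal{C}=\mathbb{Z}_k\setminus\{0\}$ for each $p\in\{0,1\}$; (iv) $\Delta_{(q,q)}\mathcal{C}=\mathbb{Z}_k\setminus\{0,\pm d_q\}$ for each $q\in\{2,3\}$, where $d_q\in\mathbb{Z}_k$ satisfies $\gcd(d_q,k)=1$; (v) $\Delta_{(r,s)}\mathcal{C}=\mathbb{Z}_k$ for each pair $(r,s)\in\mathbb{Z}_4\times\mathbb{Z}_4$ with $r\neq s$. Then there exists a $k$-ARCS$(v)$.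
   Context: For a graph $H$ with vertices in $(\mathbb{Z}_k\times\mathbb{Z}_4)\cup\{\infty\}$ and $(r,s)\in\mathbb{Z}_4\times\mathbb{Z}_4$, $\Delta_{(r,s)}H$ is the multiset $\{x-y \mid \{(x,r),(y,s)\}\in E(H)\}$ of elements of $\mathbb{Z}_k$ (for $r=s$ an edge $\{(x,r),(y,r)\}$ contributes both $x-y$ and $y-x$). For $\mathcal{C}=\{F_1,F_2\}$, $\Delta_{(r,s)}\mathcal{C}$ is the multiset union $\Delta_{(r,s)}F_1\cup\Delta_{(r,s)}F_2$, and equalities such as $\Delta_{(r,s)}\mathcal{C}=\mathbb{Z}_k$ are equalities of multisets (each listed element occurring exactly once). A $k$-cycle system of order $v$ is a collection of $k$-cycles whose edge sets partition $E(K_v)$. An almost parallel class is a collection of $(v-1)/k$ pairwise vertex-disjoint cycles of the system; for $v\equiv1\pmod{2k}$ a half-parallel class is a collection of $(v-1)/(2k)$ pairwise vertex-disjoint cycles of the system. A $k$-ARCS$(v)$ is a $k$-cycle system of order $v$ whose cycles can be partitioned into $(v-1)/2$ almost parallel classes and one half-parallel class. -}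

module Defs where

open import Data.Nat using (ℕ; zero; suc; _+_; _*_; _∸_)
open import Data.Nat.DivMod using (_mod_)
open import Data.Fin using (Fin; toℕ; _≟_) renaming (zero to fzero; suc to fsuc)
open import Data.Fin.Properties using () renaming (_≟_ to _≟ᶠ_)
open import Data.List using (List; []; _∷_; _++_; map; concatMap; filter; length; allFin)
open import Data.Maybe using (Maybe; just; nothing)
import Data.Maybe.Properties as MaybeP
import Data.Product.Properties as ProdP
open import Data.Product using (_×_; _,_; Σ; ∃; ∃-syntax)
open import Data.Sum using (_⊎_; inj₁; inj₂)
open import Data.Bool using (Bool; true; false; _∧_; if_then_else_)
open import Relation.Nullary using (¬_; Dec; yes; no; does)
open import Relation.Nullary.Decidable using (_×-dec_; _⊎-dec_)
open import Relation.Binary using (DecidableEquality)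
open import Relation.Binary.PropositionalEquality using (_≡_; _≢_)
open import Function.Definitions using (Injective)

next : {k : ℕ} → Fin k → Fin k
next {suc k} i = suc (toℕ i) mod suc k

_⊖_ : {k : ℕ} → Fin k → Fin k → Fin k
_⊖_ {suc k} x y = ((toℕ x + suc k) ∸ toℕ y) mod suc k

⊖_ : {k : ℕ} → Fin k → Fin k
⊖_ {suc k} x = fzero ⊖ x

-- k-cycles as injective cyclic sequences of vertices

record Cycle (V : Set) (k : ℕ) : Set where
  field
    verts : Fin k → V
    inj   : Injective _≡_ _≡_ verts
open Cycle public

cycleEdges : {V : Set} {k : ℕ} → Cycle V k → List (V × V)
cycleEdges {k = k} C = map (λ i → verts C i , verts C (next i)) (allFin k)

VDisjoint : {V : Set} {k : ℕ} → Cycle V k → Cycle V k → Set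
VDisjoint C D = ∀ i j → verts C i ≢ verts D j

PairwiseVDisjoint : {V : Set} {k n : ℕ} → (Fin n → Cycle V k) → Set
PairwiseVDisjoint f = ∀ a b → a ≢ b → VDisjoint (f a) (f b)

SameEdge : {V : Set} → V × V → V × V → Set
SameEdge (a , b) (c , d) = (a ≡ c × b ≡ d) ⊎ (a ≡ d × b ≡ c)

sameEdge? : {V : Set} → DecidableEquality V → (e f : V × V) → Dec (SameEdge e f)
sameEdge? _≟v_ (a , b) (c , d) = ((a ≟v c) ×-dec (b ≟v d)) ⊎-dec ((a ≟v d) ×-dec (b ≟v c))

edgeMult : {V : Set} {k : ℕ} → DecidableEquality V → List (Cycle V k) → V → V → ℕ
edgeMult dec Cs a b = length (filter (λ e → sameEdge? dec e (a , b)) (concatMap cycleEdges Cs))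

IsCycleSystem : (v k : ℕ) → List (Cycle (Fin v) k) → Set
IsCycleSystem v k Cs = ∀ (a b : Fin v) → a ≢ b → edgeMult _≟ᶠ_ Cs a b ≡ 1

-- A k-ARCS(v): a k-cycle system whose cycles are partitioned into
-- nC = (v-1)/2 almost parallel classes (each of nA = (v-1)/k pairwise
-- vertex-disjoint cycles) and one half-parallel class (nH = (v-1)/(2k)
-- pairwise vertex-disjoint cycles).
record ARCS (k v : ℕ) : Set where
  field
    nA nH nC : ℕ
    nA-def : nA * k ≡ v ∸ 1
    nH-def : nH * (2 * k) ≡ v ∸ 1
    nC-def : nC * 2 ≡ v ∸ 1
    apc : Fin nC → Fin nA → Cycle (Fin v) k
    hpc : Fin nH → Cycle (Fin v) k
    apc-almostParallel : ∀ c → PairwiseVDisjoint (apc c)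
    hpc-halfParallel : PairwiseVDisjoint hpc
    cycleSystem : IsCycleSystem v k
      (concatMap (λ c → map (apc c) (allFin nA)) (allFin nC) ++ map hpc (allFin nH))

Vtx : ℕ → Set
Vtx k = Maybe (Fin k × Fin 4)

∞ : {k : ℕ} → Vtx k
∞ = nothing

_≟ᵛ_ : {k : ℕ} → DecidableEquality (Vtx k)
_≟ᵛ_ = MaybeP.≡-dec (ProdP.≡-dec _≟ᶠ_ _≟ᶠ_)

record FourCycles (k : ℕ) : Set where
  field
    cyc : Fin 4 → Cycle (Vtx k) k
    disjoint : PairwiseVDisjoint cyc
open FourCycles public

edgesF : {k : ℕ} → FourCycles k → List (Vtx k × Vtx k)
edgesF F = concatMap (λ j → cycleEdges (cyc F j)) (allFin 4)

InV : {k : ℕ} → FourCycles k → Vtx k → Set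
InV F x = ∃[ j ] ∃[ t ] verts (cyc F j) t ≡ x

IsEdge : {k : ℕ} → FourCycles k → Vtx k → Vtx k → Set
IsEdge F x y = ∃[ j ] ∃[ t ] SameEdge (verts (cyc F j) t , verts (cyc F j) (next t)) (x , y)

-- contribution of the edge {u,w} to Δ_(r,s): x - y for each way of
-- writing it as {(x,r),(y,s)} (so both x-y and y-x when r = s)
contrib : {k : ℕ} → Fin 4 → Fin 4 → Vtx k × Vtx k → List (Fin k)
contrib r s (just (x , a) , just (y , b)) =
  (if does (a ≟ᶠ r) ∧ does (b ≟ᶠ s) then (x ⊖ y) ∷ [] else []) ++
  (if does (a ≟ᶠ s) ∧ does (b ≟ᶠ r) then (y ⊖ x) ∷ [] else [])
contrib r s _ = []

Δ : {k : ℕ} → Fin 4 → Fin 4 → FourCycles k → List (Fin k)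
Δ r s F = concatMap (contrib r s) (edgesF F)

Δ₂ : {k : ℕ} → Fin 4 → Fin 4 → FourCycles k → FourCycles k → List (Fin k)
Δ₂ r s F₁ F₂ = Δ r s F₁ ++ Δ r s F₂

mult : {k : ℕ} → Fin k → List (Fin k) → ℕ
mult z L = length (filter (λ x → x ≟ᶠ z) L)

MSetEq : {k : ℕ} → List (Fin k) → (Fin k → Set) → Set
MSetEq L P = ∀ z → (P z → mult z L ≡ 1) × (¬ P z → mult z L ≡ 0)

IsZero : {k : ℕ} → Fin k → Set
IsZero z = toℕ z ≡ 0

-- Develop F₁ and F₂ under the translations (x, j) ↦ (x + t, j), t ∈ ℤ_k: the 2k translates are the
-- almost parallel classes (a translate of Fᵢ misses one point).  An edge {(x,r),(y,s)} of K_Γ lies in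
-- as many translates as x − y occurs in Δ_(r,s)𝒞, so by (iii)–(v) every such edge is covered once,
-- except the edges of difference ±d_q inside a level q ∈ {2,3}.  As gcd(d_q, k) = 1, these form the
-- k-cycle (0, d_q, 2d_q, …) × {q}, and the two such cycles make up the half-parallel class.  An edge
-- {∞,(y,s)} lies in one translate for each neighbour of ∞ at level s in F₁ or F₂; by (ii) these four
-- neighbours meet all four levels, so each level exactly once.

module Submission where

open import Defs
open import Data.Nat using (ℕ; zero; suc; _+_; _*_; _∸_; _≤_; _<_; z≤n; s≤s; _%_)
import Data.Nat as ℕ
open import Data.Nat.Properties
  using (+-0-commutativeMonoid; +-assoc; +-comm; +-identityʳ; *-assoc; *-comm; *-distribʳ-+;
         ≤-trans; ≤-antisym; ≤-total; ≤-<-trans; <⇒≤; <⇒≢; <⇒≱; n<1+n; m≤n+m;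
         m∸n+n≡m; m+[n∸m]≡n; m+n∸n≡m; m∸n≡0⇒m≤n; m∸n≤m)
open import Algebra.Properties.CommutativeMonoid.Sum +-0-commutativeMonoid
  using (sum; sum-syntax; sum-cong-≗; ∑-distrib-+; ∑-comm; sum-remove; sum-replicate-zero)
open import Data.Nat.DivMod using (_mod_; %-distribˡ-+; %-distribˡ-*; [m+n]%n≡m%n; m%n%n≡m%n; m%n<n; m<n⇒m%n≡m)
open import Data.Nat.Divisibility using (_∣_; m%n≡0⇒n∣m; n∣m⇒m%n≡0; ∣⇒≤)
open import Data.Nat.Coprimality using (Coprime; coprime-divisor)
import Data.Nat.Coprimality as Coprime
open import Data.Nat.Tactic.RingSolver using (solve-∀)
open import Data.Bool using (_∧_; if_then_else_)
open import Data.Fin using (Fin; toℕ; punchOut; punchIn; splitAt; combine; remQuot; _↑ʳ_)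
  renaming (zero to fzero; suc to fsuc)
open import Data.Fin.Properties
  using (toℕ-injective; toℕ-fromℕ<; toℕ<n; any?; all?; pigeonhole; punchOut-injective; punchInᵢ≢i;
         ↑ʳ-injective; +↔⊎; 1↔⊤; remQuot-combine; combine-remQuot)
  renaming (_≟_ to _≟ᶠ_)
open import Data.List using (List; []; _∷_; _++_; map; concatMap; filter; length; tabulate; allFin)
open import Data.List.Properties using (length-++; filter-++; concatMap-++; concatMap-map)
open import Data.Maybe using (Maybe; just; nothing; maybe)
import Data.Maybe as Maybe
open import Data.Maybe.Properties using (just-injective)
open import Data.Product using (_×_; _,_; proj₁; proj₂; ∃-syntax; swap; map₁; uncurry)
import Data.Product as Product
open import Data.Product.Algebra using (×-comm)
open import Data.Product.Properties using (,-injectiveˡ; ,-injectiveʳ)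
open import Data.Sum using (_⊎_; inj₁; inj₂)
import Data.Sum as Sum
open import Data.Sum.Function.Propositional using (_⊎-↔_)
open import Data.Unit using (⊤; tt)
open import Data.Vec.Functional using (Vector) renaming (_++_ to _++ᵛ_)
open import Function using (_∘_; _↔_; Inverse; mk↔ₛ′)
import Function.Bundles
open import Function.Definitions using (Injective)
open import Function.Properties.Inverse using (↔-sym; ↔-trans; Inverse⇒Injection)
open import Relation.Binary using (DecidableEquality)
open import Relation.Binary.PropositionalEquality
open import Relation.Nullary using (¬_; Dec; yes; no; does; contradiction)
open import Relation.Nullary.Decidable using (_×-dec_; _⊎-dec_; _→-dec_; toWitness)
open import Relation.Unary using (Pred; Decidable)

-- Arithmetic in ℤ_N

module _ {n : ℕ} where
  private
    N : ℕ
    N = suc n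

  infixl 7 _·_
  infixl 6 _⊕_

  _⊕_ : Fin N → Fin N → Fin N
  x ⊕ y = (toℕ x + toℕ y) mod N

  _·_ : Fin N → Fin N → Fin N
  i · d = (toℕ i * toℕ d) mod N

  toℕ-mod : ∀ a → toℕ (a mod N) ≡ a % N
  toℕ-mod a = toℕ-fromℕ< (m%n<n a N)

  mod-cong : ∀ a b → a % N ≡ b % N → a mod N ≡ b mod N
  mod-cong a b e = toℕ-injective (trans (toℕ-mod a) (trans e (sym (toℕ-mod b))))

  toℕ%N : ∀ (x : Fin N) → toℕ x % N ≡ toℕ x
  toℕ%N x = m<n⇒m%n≡m (toℕ<n x)

  [m%N+o]%N≡[m+o]%N : ∀ m o → (m % N + o) % N ≡ (m + o) % N
  [m%N+o]%N≡[m+o]%N m o = begin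
    (m % N + o) % N          ≡⟨ %-distribˡ-+ (m % N) o N ⟩
    (m % N % N + o % N) % N  ≡⟨ cong (λ a → (a + o % N) % N) (m%n%n≡m%n m N) ⟩
    (m % N + o % N) % N      ≡⟨ %-distribˡ-+ m o N ⟨
    (m + o) % N              ∎
    where open ≡-Reasoning

  [m+o%N]%N≡[m+o]%N : ∀ m o → (m + o % N) % N ≡ (m + o) % N
  [m+o%N]%N≡[m+o]%N m o = begin
    (m + o % N) % N  ≡⟨ cong (_% N) (+-comm m (o % N)) ⟩
    (o % N + m) % N  ≡⟨ [m%N+o]%N≡[m+o]%N o m ⟩
    (o + m) % N      ≡⟨ cong (_% N) (+-comm o m) ⟩
    (m + o) % N      ∎
    where open ≡-Reasoning

  toℕ-⊕ : ∀ x y → toℕ (x ⊕ y) ≡ (toℕ x + toℕ y) % N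
  toℕ-⊕ x y = toℕ-mod (toℕ x + toℕ y)

  ⊕-comm : ∀ x y → x ⊕ y ≡ y ⊕ x
  ⊕-comm x y = cong (_mod N) (+-comm (toℕ x) (toℕ y))

  ⊕-assoc : ∀ x y z → (x ⊕ y) ⊕ z ≡ x ⊕ (y ⊕ z)
  ⊕-assoc x y z = mod-cong (toℕ (x ⊕ y) + toℕ z) (toℕ x + toℕ (y ⊕ z)) (begin
    (toℕ (x ⊕ y) + toℕ z) % N    ≡⟨ cong (λ a → (a + toℕ z) % N) (toℕ-⊕ x y) ⟩
    ((toℕ x + toℕ y) % N + toℕ z) % N ≡⟨ [m%N+o]%N≡[m+o]%N (toℕ x + toℕ y) (toℕ z) ⟩
    (toℕ x + toℕ y + toℕ z) % N   ≡⟨ cong (_% N) (+-assoc (toℕ x) (toℕ y) (toℕ z)) ⟩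
    (toℕ x + (toℕ y + toℕ z)) % N ≡⟨ [m+o%N]%N≡[m+o]%N (toℕ x) (toℕ y + toℕ z) ⟨
    (toℕ x + (toℕ y + toℕ z) % N) % N ≡⟨ cong (λ a → (toℕ x + a) % N) (toℕ-⊕ y z) ⟨
    (toℕ x + toℕ (y ⊕ z)) % N     ∎)
    where open ≡-Reasoning

  ⊕-identityʳ : ∀ x → x ⊕ fzero ≡ x
  ⊕-identityʳ x = toℕ-injective (trans (toℕ-⊕ x fzero)
    (trans (cong (_% N) (+-identityʳ (toℕ x))) (toℕ%N x)))

  ⊕-identityˡ : ∀ x → fzero ⊕ x ≡ x
  ⊕-identityˡ x = trans (⊕-comm fzero x) (⊕-identityʳ x)

  x⊖y⊕y≡x : ∀ x y → (x ⊖ y) ⊕ y ≡ x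
  x⊖y⊕y≡x x y = toℕ-injective (begin
    toℕ ((x ⊖ y) ⊕ y)                       ≡⟨ toℕ-⊕ (x ⊖ y) y ⟩
    (toℕ (x ⊖ y) + toℕ y) % N               ≡⟨ cong (λ a → (a + toℕ y) % N) (toℕ-mod (toℕ x + N ∸ toℕ y)) ⟩
    ((toℕ x + N ∸ toℕ y) % N + toℕ y) % N   ≡⟨ [m%N+o]%N≡[m+o]%N (toℕ x + N ∸ toℕ y) (toℕ y) ⟩
    (toℕ x + N ∸ toℕ y + toℕ y) % N         ≡⟨ cong (_% N) (m∸n+n≡m y≤x+N) ⟩
    (toℕ x + N) % N                         ≡⟨ [m+n]%n≡m%n (toℕ x) N ⟩
    toℕ x % N                               ≡⟨ toℕ%N x ⟩
    toℕ x                                   ∎)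
    where
    open ≡-Reasoning
    y≤x+N : toℕ y ≤ toℕ x + N
    y≤x+N = ≤-trans (<⇒≤ (toℕ<n y)) (m≤n+m N (toℕ x))

  x⊕[y⊖x]≡y : ∀ x y → x ⊕ (y ⊖ x) ≡ y
  x⊕[y⊖x]≡y x y = trans (⊕-comm x (y ⊖ x)) (x⊖y⊕y≡x y x)

  ⊕-cancelʳ : ∀ x {t u} → t ⊕ x ≡ u ⊕ x → t ≡ u
  ⊕-cancelʳ x {t} {u} e = begin
    t                      ≡⟨ undo t ⟨
    (t ⊕ x) ⊕ (⊖ x)        ≡⟨ cong (_⊕ (⊖ x)) e ⟩
    (u ⊕ x) ⊕ (⊖ x)        ≡⟨ undo u ⟩
    u                      ∎
    where
    open ≡-Reasoning
    undo : ∀ w → (w ⊕ x) ⊕ (⊖ x) ≡ w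
    undo w = trans (⊕-assoc w x (⊖ x)) (trans (cong (w ⊕_) (x⊕[y⊖x]≡y x fzero)) (⊕-identityʳ w))

  ⊕-cancelˡ : ∀ x {t u} → x ⊕ t ≡ x ⊕ u → t ≡ u
  ⊕-cancelˡ x {t} {u} e = ⊕-cancelʳ x (trans (⊕-comm t x) (trans e (⊕-comm x u)))

  ⊕≡⇒≡⊖ : ∀ {t x y} → t ⊕ x ≡ y → t ≡ y ⊖ x
  ⊕≡⇒≡⊖ {t} {x} {y} e = ⊕-cancelʳ x (trans e (sym (x⊖y⊕y≡x y x)))

  ⊖-translate : ∀ x′ y′ t x y → x′ ⊕ t ≡ x → y′ ⊕ t ≡ y → x′ ⊖ y′ ≡ x ⊖ y
  ⊖-translate x′ y′ t x y ex ey = ⊕≡⇒≡⊖ (begin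
    (x′ ⊖ y′) ⊕ y          ≡⟨ cong ((x′ ⊖ y′) ⊕_) ey ⟨
    (x′ ⊖ y′) ⊕ (y′ ⊕ t)   ≡⟨ ⊕-assoc (x′ ⊖ y′) y′ t ⟨
    ((x′ ⊖ y′) ⊕ y′) ⊕ t   ≡⟨ cong (_⊕ t) (x⊖y⊕y≡x x′ y′) ⟩
    x′ ⊕ t                 ≡⟨ ex ⟩
    x                      ∎)
    where open ≡-Reasoning

  ⊖-translate⁻¹ : ∀ x′ y′ t x y → x′ ⊕ t ≡ x → x′ ⊖ y′ ≡ x ⊖ y → y′ ⊕ t ≡ y
  ⊖-translate⁻¹ x′ y′ t x y ex ed = ⊕-cancelˡ (x ⊖ y) (begin
    (x ⊖ y) ⊕ (y′ ⊕ t)     ≡⟨ cong (_⊕ (y′ ⊕ t)) ed ⟨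
    (x′ ⊖ y′) ⊕ (y′ ⊕ t)   ≡⟨ ⊕-assoc (x′ ⊖ y′) y′ t ⟨
    ((x′ ⊖ y′) ⊕ y′) ⊕ t   ≡⟨ cong (_⊕ t) (x⊖y⊕y≡x x′ y′) ⟩
    x′ ⊕ t                 ≡⟨ ex ⟩
    x                      ≡⟨ x⊖y⊕y≡x x y ⟨
    (x ⊖ y) ⊕ y            ∎)
    where open ≡-Reasoning

  one : Fin N
  one = 1 mod N

  next≡⊕one : ∀ (i : Fin N) → next i ≡ i ⊕ one
  next≡⊕one i = mod-cong (suc (toℕ i)) (toℕ i + toℕ one) (begin
    suc (toℕ i) % N            ≡⟨ cong (_% N) (+-comm 1 (toℕ i)) ⟩
    (toℕ i + 1) % N            ≡⟨ [m+o%N]%N≡[m+o]%N (toℕ i) 1 ⟨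
    (toℕ i + 1 % N) % N        ≡⟨ cong (λ a → (toℕ i + a) % N) (toℕ-mod 1) ⟨
    (toℕ i + toℕ one) % N      ∎)
    where open ≡-Reasoning

  next≢id : 1 ≤ n → ∀ (i : Fin N) → next i ≢ i
  next≢id 1≤n i e = contradiction toℕ-one≡0 λ ()
    where
    one≡0 : one ≡ fzero
    one≡0 = ⊕-cancelˡ i (trans (sym (next≡⊕one i)) (trans e (sym (⊕-identityʳ i))))
    toℕ-one≡0 : 1 ≡ 0
    toℕ-one≡0 = trans (sym (m<n⇒m%n≡m (s≤s 1≤n))) (trans (sym (toℕ-mod 1)) (cong toℕ one≡0))

  next-· : ∀ (i d : Fin N) → next i · d ≡ i · d ⊕ d
  next-· i d = mod-cong (toℕ (next i) * toℕ d) (toℕ (i · d) + toℕ d) (begin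
    toℕ (next i) * toℕ d % N              ≡⟨ cong (λ a → a * toℕ d % N) (toℕ-mod (suc (toℕ i))) ⟩
    suc (toℕ i) % N * toℕ d % N           ≡⟨ %-distribˡ-* (suc (toℕ i) % N) (toℕ d) N ⟩
    suc (toℕ i) % N % N * (toℕ d % N) % N ≡⟨ cong (λ a → a * (toℕ d % N) % N) (m%n%n≡m%n (suc (toℕ i)) N) ⟩
    suc (toℕ i) % N * (toℕ d % N) % N     ≡⟨ %-distribˡ-* (suc (toℕ i)) (toℕ d) N ⟨
    (toℕ d + toℕ i * toℕ d) % N           ≡⟨ cong (_% N) (+-comm (toℕ d) (toℕ i * toℕ d)) ⟩
    (toℕ i * toℕ d + toℕ d) % N           ≡⟨ [m%N+o]%N≡[m+o]%N (toℕ i * toℕ d) (toℕ d) ⟨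
    (toℕ i * toℕ d % N + toℕ d) % N       ≡⟨ cong (λ a → (a + toℕ d) % N) (toℕ-mod (toℕ i * toℕ d)) ⟨
    (toℕ (i · d) + toℕ d) % N             ∎)
    where open ≡-Reasoning

  [m+o]%N≡m%N⇒N∣o : ∀ m o → (m + o) % N ≡ m % N → N ∣ o
  [m+o]%N≡m%N⇒N∣o m o e = m%n≡0⇒n∣m o N (trans (sym (toℕ-mod o)) (cong toℕ O≡0))
    where
    M O : Fin N
    M = m mod N
    O = o mod N
    M⊕O≡M⊕0 : M ⊕ O ≡ M ⊕ fzero
    M⊕O≡M⊕0 = toℕ-injective (begin
      toℕ (M ⊕ O)              ≡⟨ toℕ-⊕ M O ⟩
      (toℕ M + toℕ O) % N      ≡⟨ cong₂ (λ a b → (a + b) % N) (toℕ-mod m) (toℕ-mod o) ⟩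
      (m % N + o % N) % N      ≡⟨ %-distribˡ-+ m o N ⟨
      (m + o) % N              ≡⟨ e ⟩
      m % N                    ≡⟨ toℕ-mod m ⟨
      toℕ M                    ≡⟨ cong toℕ (⊕-identityʳ M) ⟨
      toℕ (M ⊕ fzero)          ∎)
      where open ≡-Reasoning
    O≡0 : O ≡ fzero
    O≡0 = ⊕-cancelˡ M M⊕O≡M⊕0

  private
    ·-injective-≤ : ∀ (d : Fin N) → Coprime N (toℕ d) → ∀ {i j} → toℕ i ≤ toℕ j → i · d ≡ j · d → i ≡ j
    ·-injective-≤ d N⊥d {i} {j} i≤j e = toℕ-injective (≤-antisym i≤j (m∸n≡0⇒m≤n δ≡0))
      where
      δ : ℕ
      δ = toℕ j ∸ toℕ i
      shifted : (toℕ i * toℕ d + δ * toℕ d) % N ≡ (toℕ i * toℕ d) % N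
      shifted = begin
        (toℕ i * toℕ d + δ * toℕ d) % N  ≡⟨ cong (_% N) (*-distribʳ-+ (toℕ d) (toℕ i) δ) ⟨
        ((toℕ i + δ) * toℕ d) % N        ≡⟨ cong (λ a → a * toℕ d % N) (m+[n∸m]≡n i≤j) ⟩
        (toℕ j * toℕ d) % N              ≡⟨ toℕ-mod (toℕ j * toℕ d) ⟨
        toℕ (j · d)                      ≡⟨ cong toℕ e ⟨
        toℕ (i · d)                      ≡⟨ toℕ-mod (toℕ i * toℕ d) ⟩
        (toℕ i * toℕ d) % N              ∎
        where open ≡-Reasoning
      N∣δ : N ∣ δ
      N∣δ = coprime-divisor N⊥d
        (subst (N ∣_) (*-comm δ (toℕ d)) ([m+o]%N≡m%N⇒N∣o (toℕ i * toℕ d) (δ * toℕ d) shifted))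
      δ≡0 : δ ≡ 0
      δ≡0 = trans (sym (m<n⇒m%n≡m (≤-<-trans (m∸n≤m (toℕ j) (toℕ i)) (toℕ<n j)))) (n∣m⇒m%n≡0 δ N N∣δ)

  ·-injective : ∀ (d : Fin N) → Coprime N (toℕ d) → Injective _≡_ _≡_ (_· d)
  ·-injective d N⊥d {i} {j} e with ≤-total (toℕ i) (toℕ j)
  ... | inj₁ i≤j = ·-injective-≤ d N⊥d i≤j e
  ... | inj₂ j≤i = sym (·-injective-≤ d N⊥d j≤i (sym e))

  -- d ⊕ d ≡ 0 would force N ∣ 2.
  d≢⊖d : 2 ≤ n → ∀ (d : Fin N) → Coprime N (toℕ d) → d ≢ ⊖ d
  d≢⊖d 2≤n d N⊥d e = contradiction (∣⇒≤ N∣2) (<⇒≱ (s≤s 2≤n))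
    where
    d⊕d≡0 : d ⊕ d ≡ fzero
    d⊕d≡0 = trans (cong (_⊕ d) e) (x⊖y⊕y≡x fzero d)
    N∣d*2 : N ∣ toℕ d * 2
    N∣d*2 = m%n≡0⇒n∣m (toℕ d * 2) N (begin
      toℕ d * 2 % N           ≡⟨ cong (_% N) (*-comm (toℕ d) 2) ⟩
      (toℕ d + (toℕ d + 0)) % N ≡⟨ cong (λ a → (toℕ d + a) % N) (+-identityʳ (toℕ d)) ⟩
      (toℕ d + toℕ d) % N     ≡⟨ toℕ-⊕ d d ⟨
      toℕ (d ⊕ d)             ≡⟨ cong toℕ d⊕d≡0 ⟩
      0                       ∎)
      where open ≡-Reasoning
    N∣2 : N ∣ 2
    N∣2 = coprime-divisor N⊥d N∣d*2

-- Finite sums and counting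

injective⇒surjective : ∀ {m} (f : Fin m → Fin m) → Injective _≡_ _≡_ f → ∀ y → ∃[ i ] f i ≡ y
injective⇒surjective f f-inj y with any? (λ i → f i ≟ᶠ y)
... | yes hit = hit
injective⇒surjective {suc m} f f-inj y | no miss
  with i , j , i<j , eq ← pigeonhole (n<1+n m) (λ i → punchOut {i = y} {j = f i} λ e → miss (i , sym e))
  = contradiction (cong toℕ (f-inj (punchOut-injective {i = y} _ _ eq))) (<⇒≢ i<j)

𝟙 : ∀ {a} {A : Set a} → Dec A → ℕ
𝟙 (yes _) = 1
𝟙 (no _)  = 0

module _ {a b} {A : Set a} {B : Set b} where

  𝟙-cong : (A → B) → (B → A) → (p : Dec A) (q : Dec B) → 𝟙 p ≡ 𝟙 q
  𝟙-cong f g (yes _) (yes _) = refl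
  𝟙-cong f g (yes a) (no ¬b) = contradiction (f a) ¬b
  𝟙-cong f g (no ¬a) (yes b) = contradiction (g b) ¬a
  𝟙-cong f g (no _)  (no _)  = refl

  𝟙-⊎ : ¬ (A × B) → (p : Dec A) (q : Dec B) → 𝟙 (p ⊎-dec q) ≡ 𝟙 p + 𝟙 q
  𝟙-⊎ both (yes a) (yes b) = contradiction (a , b) both
  𝟙-⊎ both (yes _) (no _)  = refl
  𝟙-⊎ both (no _)  (yes _) = refl
  𝟙-⊎ both (no _)  (no _)  = refl

𝟙-no : ∀ {a} {A : Set a} → ¬ A → (p : Dec A) → 𝟙 p ≡ 0
𝟙-no ¬a (yes a) = contradiction a ¬a
𝟙-no ¬a (no _)  = refl

∑-zero : ∀ {n} (f : Vector ℕ n) → (∀ i → f i ≡ 0) → sum f ≡ 0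
∑-zero {n} f f≡0 = trans (sum-cong-≗ f≡0) (sum-replicate-zero n)

∑-single : ∀ {n} (f : Vector ℕ (suc n)) i₀ → (∀ i → i ≢ i₀ → f i ≡ 0) → sum f ≡ f i₀
∑-single f i₀ f≡0 = begin
  sum f                              ≡⟨ sum-remove {i = i₀} f ⟩
  f i₀ + ∑[ j < _ ] f (punchIn i₀ j)  ≡⟨ cong (f i₀ +_) (∑-zero _ (λ j → f≡0 _ (punchInᵢ≢i i₀ j))) ⟩
  f i₀ + 0                           ≡⟨ +-identityʳ (f i₀) ⟩
  f i₀                               ∎
  where open ≡-Reasoning

∑-++ : ∀ {m n} (f : Vector ℕ m) (g : Vector ℕ n) → sum (f ++ᵛ g) ≡ sum f + sum g
∑-++ {zero}  f g = refl
∑-++ {suc m} f g = trans (cong (f fzero +_) (trans (sum-cong-≗ tail-++) (∑-++ (f ∘ fsuc) g)))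
                         (sym (+-assoc (f fzero) _ _))
  where
  tail-++ : ∀ i → (f ++ᵛ g) (fsuc i) ≡ ((f ∘ fsuc) ++ᵛ g) i
  tail-++ i with splitAt m i
  ... | inj₁ _ = refl
  ... | inj₂ _ = refl

∑-𝟙-unique : ∀ {n p} {P : Fin (suc n) → Set p} (P? : ∀ t → Dec (P t)) t₀ →
  (∀ t → P t → t ≡ t₀) → ∑[ t < suc n ] 𝟙 (P? t) ≡ 𝟙 (P? t₀)
∑-𝟙-unique P? t₀ unique = ∑-single _ t₀ (λ t t≢t₀ → 𝟙-no (t≢t₀ ∘ unique t) (P? t))

module _ {b p} {B : Set b} {P : Pred B p} (P? : Decidable P) where

  count : List B → ℕ
  count xs = length (filter P? xs)

  count-++ : ∀ xs ys → count (xs ++ ys) ≡ count xs + count ys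
  count-++ xs ys = trans (cong length (filter-++ P? xs ys)) (length-++ (filter P? xs))

module _ {a b p} {A : Set a} {B : Set b} {P : Pred B p} (P? : Decidable P) where

  count-concatMap-tabulate : ∀ {n} (f : A → List B) (g : Fin n → A) →
    count P? (concatMap f (tabulate g)) ≡ ∑[ i < n ] count P? (f (g i))
  count-concatMap-tabulate {zero}  f g = refl
  count-concatMap-tabulate {suc n} f g =
    trans (count-++ P? (f (g fzero)) _) (cong (count P? (f (g fzero)) +_) (count-concatMap-tabulate f (g ∘ fsuc)))

  count-map-tabulate : ∀ {n} (f : A → B) (g : Fin n → A) →
    count P? (map f (tabulate g)) ≡ ∑[ i < n ] 𝟙 (P? (f (g i)))
  count-map-tabulate {zero}  f g = refl
  count-map-tabulate {suc n} f g with P? (f (g fzero))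
  ... | yes _ = cong suc (count-map-tabulate f (g ∘ fsuc))
  ... | no _  = count-map-tabulate f (g ∘ fsuc)

concatMap-concatMap : ∀ {a b c} {A : Set a} {B : Set b} {C : Set c}
  (f : B → List C) (g : A → List B) xs → concatMap f (concatMap g xs) ≡ concatMap (concatMap f ∘ g) xs
concatMap-concatMap f g []       = refl
concatMap-concatMap f g (x ∷ xs) =
  trans (concatMap-++ f (g x) (concatMap g xs)) (cong (concatMap f (g x) ++_) (concatMap-concatMap f g xs))

𝟙-×-comm : ∀ {a b} {A : Set a} {B : Set b} (p : Dec A) (q : Dec B) → 𝟙 (p ×-dec q) ≡ 𝟙 (q ×-dec p)
𝟙-×-comm p q = 𝟙-cong swap swap (p ×-dec q) (q ×-dec p)

∑∑-single : ∀ {m k} (f : Fin (suc m) → Fin (suc k) → ℕ) j₀ i₀ →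
  (∀ j i → ¬ (j ≡ j₀ × i ≡ i₀) → f j i ≡ 0) → ∑[ j < suc m ] ∑[ i < suc k ] f j i ≡ f j₀ i₀
∑∑-single f j₀ i₀ f≡0 =
  trans (∑-single _ j₀ (λ j j≢j₀ → ∑-zero (f j) (λ i → f≡0 j i (j≢j₀ ∘ proj₁))))
        (∑-single (f j₀) i₀ (λ i i≢i₀ → f≡0 j₀ i (i≢i₀ ∘ proj₂)))

module _ {n : ℕ} where
  private
    N : ℕ
    N = suc n

  ≢⇒⊖-nonzero : ∀ {x y : Fin N} → x ≢ y → ¬ IsZero (x ⊖ y)
  ≢⇒⊖-nonzero {x} {y} x≢y x⊖y≡0 = x≢y (begin
    x                ≡⟨ x⊖y⊕y≡x x y ⟨
    (x ⊖ y) ⊕ y      ≡⟨ cong (_⊕ y) (toℕ-injective {i = x ⊖ y} {j = fzero} x⊖y≡0) ⟩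
    fzero ⊕ y        ≡⟨ ⊕-identityˡ y ⟩
    y                ∎)
    where open ≡-Reasoning

  module _ (d : Fin N) (d≢⊖d : d ≢ ⊖ d) (L : List (Fin N))
           (L≡ : MSetEq L (λ z → ¬ IsZero z × z ≢ d × z ≢ ⊖ d)) where

    mult-around-d : ∀ z → ¬ IsZero z → mult z L + (𝟙 (z ≟ᶠ ⊖ d) + 𝟙 (z ≟ᶠ d)) ≡ 1
    mult-around-d z z≢0 with z ≟ᶠ ⊖ d | z ≟ᶠ d
    ... | yes z≡-d | yes z≡d = contradiction (trans (sym z≡d) z≡-d) d≢⊖d
    ... | yes z≡-d | no _    = cong (_+ 1) (proj₂ (L≡ z) (λ (_ , _ , z≢-d) → z≢-d z≡-d))
    ... | no _     | yes z≡d = cong (_+ 1) (proj₂ (L≡ z) (λ (_ , z≢d , _) → z≢d z≡d))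
    ... | no z≢-d  | no z≢d  = cong (_+ 0) (proj₁ (L≡ z) (z≢0 , z≢d , z≢-d))

    -- The two indicators count {x, y} as an edge of the cycle (0, d, 2d, …): they supply the
    -- differences ±d missing from L.
    mult-with-halfEdges : ∀ x y → x ≢ y → mult (x ⊖ y) L + (𝟙 (x ⊕ d ≟ᶠ y) + 𝟙 (y ⊕ d ≟ᶠ x)) ≡ 1
    mult-with-halfEdges x y x≢y = trans
      (cong (mult (x ⊖ y) L +_) (cong₂ _+_
        (𝟙-cong (λ e → sym (⊖-translate fzero d x x y (⊕-identityˡ x) (trans (⊕-comm d x) e)))
                (λ e → trans (⊕-comm x d) (⊖-translate⁻¹ fzero d x x y (⊕-identityˡ x) (sym e)))
                (x ⊕ d ≟ᶠ y) (x ⊖ y ≟ᶠ ⊖ d))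
        (𝟙-cong (λ e → sym (⊕≡⇒≡⊖ (trans (⊕-comm d y) e)))
                (λ e → trans (cong (y ⊕_) (sym e)) (x⊕[y⊖x]≡y y x))
                (y ⊕ d ≟ᶠ x) (x ⊖ y ≟ᶠ d))))
      (mult-around-d (x ⊖ y) (≢⇒⊖-nonzero x≢y))

-- Edge counts of lists of cycles

module _ {V : Set} (_≟_ : DecidableEquality V) where

  edgeCount : ∀ {k} → Cycle V k → V → V → ℕ
  edgeCount {k} C a b = ∑[ i < k ] 𝟙 (sameEdge? _≟_ (verts C i , verts C (next i)) (a , b))

  edgeMult-classes : ∀ {k nC nA nH} (apc : Fin nC → Fin nA → Cycle V k) (hpc : Fin nH → Cycle V k) a b →
    edgeMult _≟_ (concatMap (λ c → map (apc c) (allFin nA)) (allFin nC) ++ map hpc (allFin nH)) a b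
      ≡ ∑[ c < nC ] ∑[ j < nA ] edgeCount (apc c j) a b + ∑[ h < nH ] edgeCount (hpc h) a b
  edgeMult-classes {k} {nC} {nA} {nH} apc hpc a b = begin
    count P? (concatMap cycleEdges (classes ++ halfClass))
      ≡⟨ cong (count P?) (concatMap-++ cycleEdges classes halfClass) ⟩
    count P? (concatMap cycleEdges classes ++ concatMap cycleEdges halfClass)
      ≡⟨ count-++ P? (concatMap cycleEdges classes) _ ⟩
    count P? (concatMap cycleEdges classes) + count P? (concatMap cycleEdges halfClass)
      ≡⟨ cong₂ _+_
           (trans (cong (count P?) (concatMap-concatMap cycleEdges class (allFin nC)))
             (trans (count-concatMap-tabulate P? (concatMap cycleEdges ∘ class) (λ c → c))
                    (sum-cong-≗ λ c → count-cycles (apc c))))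
           (count-cycles hpc) ⟩
    ∑[ c < nC ] ∑[ j < nA ] edgeCount (apc c j) a b + ∑[ h < nH ] edgeCount (hpc h) a b
      ∎
    where
    open ≡-Reasoning
    P? : Decidable (λ e → SameEdge e (a , b))
    P? e = sameEdge? _≟_ e (a , b)
    class : Fin nC → List (Cycle V k)
    class c = map (apc c) (allFin nA)
    classes halfClass : List (Cycle V k)
    classes = concatMap class (allFin nC)
    halfClass = map hpc (allFin nH)
    count-cycles : ∀ {m} (cs : Fin m → Cycle V k) →
      count P? (concatMap cycleEdges (map cs (allFin m))) ≡ ∑[ i < m ] edgeCount (cs i) a b
    count-cycles {m} cs = begin
      count P? (concatMap cycleEdges (map cs (allFin m)))   ≡⟨ cong (count P?) (concatMap-map cycleEdges cs (allFin m)) ⟩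
      count P? (concatMap (cycleEdges ∘ cs) (allFin m))     ≡⟨ count-concatMap-tabulate P? (cycleEdges ∘ cs) (λ i → i) ⟩
      ∑[ i < m ] count P? (cycleEdges (cs i))
        ≡⟨ sum-cong-≗ (λ i → count-map-tabulate P? (λ t → verts (cs i) t , verts (cs i) (next t)) (λ t → t)) ⟩
      ∑[ i < m ] edgeCount (cs i) a b                       ∎

  𝟙-sameEdge-flip : ∀ u w a b → 𝟙 (sameEdge? _≟_ (u , w) (a , b)) ≡ 𝟙 (sameEdge? _≟_ (w , u) (a , b))
  𝟙-sameEdge-flip u w a b = 𝟙-cong flip flip (sameEdge? _≟_ (u , w) (a , b)) (sameEdge? _≟_ (w , u) (a , b))
    where
    flip : ∀ {u w} → SameEdge (u , w) (a , b) → SameEdge (w , u) (a , b)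
    flip (inj₁ (p , q)) = inj₂ (q , p)
    flip (inj₂ (p , q)) = inj₁ (q , p)

  edgeCount-comm : ∀ {k} (C : Cycle V k) a b → edgeCount C a b ≡ edgeCount C b a
  edgeCount-comm C a b = sum-cong-≗ λ i → 𝟙-cong Sum.swap Sum.swap
    (sameEdge? _≟_ (verts C i , verts C (next i)) (a , b)) (sameEdge? _≟_ (verts C i , verts C (next i)) (b , a))

  edgeCount-absent : ∀ {k} (C : Cycle V k) u w → (∀ i → verts C i ≢ u) → edgeCount C u w ≡ 0
  edgeCount-absent C u w absent = ∑-zero _ λ i → 𝟙-no
    (λ { (inj₁ (p , _)) → absent i p ; (inj₂ (_ , q)) → absent (next i) q })
    (sameEdge? _≟_ (verts C i , verts C (next i)) (u , w))

mapCycle : ∀ {A B : Set} {k} (f : A → B) → Injective _≡_ _≡_ f → Cycle A k → Cycle B k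
mapCycle f f-inj C = record { verts = f ∘ verts C ; inj = λ e → inj C (f-inj e) }

mapCycle-pairwiseVDisjoint : ∀ {A B : Set} {k n} (f : A → B) (f-inj : Injective _≡_ _≡_ f)
  (cs : Fin n → Cycle A k) → PairwiseVDisjoint cs → PairwiseVDisjoint (mapCycle f f-inj ∘ cs)
mapCycle-pairwiseVDisjoint f f-inj cs disj a b a≢b i j e = disj a b a≢b i j (f-inj e)

to-injective : ∀ {A B : Set} (A↔B : A ↔ B) → Injective _≡_ _≡_ (Inverse.to A↔B)
to-injective A↔B = Function.Bundles.Injection.injective (Inverse⇒Injection A↔B)

module _ {A B : Set} (A↔B : A ↔ B) (_≟ᴬ_ : DecidableEquality A) (_≟ᴮ_ : DecidableEquality B) where
  open Inverse A↔B

  edgeCount-↔ : ∀ {k} (C : Cycle A k) a b →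
    edgeCount _≟ᴮ_ (mapCycle to (to-injective A↔B) C) a b ≡ edgeCount _≟ᴬ_ C (from a) (from b)
  edgeCount-↔ C a b = sum-cong-≗ λ i → 𝟙-cong
    (Sum.map (Product.map to≡⇒≡from to≡⇒≡from) (Product.map to≡⇒≡from to≡⇒≡from))
    (Sum.map (Product.map ≡from⇒to≡ ≡from⇒to≡) (Product.map ≡from⇒to≡ ≡from⇒to≡))
    (sameEdge? _≟ᴮ_ (to (verts C i) , to (verts C (next i))) (a , b))
    (sameEdge? _≟ᴬ_ (verts C i , verts C (next i)) (from a , from b))
    where
    to≡⇒≡from : ∀ {x y} → to x ≡ y → x ≡ from y
    to≡⇒≡from e = sym (inverseʳ (sym e))
    ≡from⇒to≡ : ∀ {x y} → x ≡ from y → to x ≡ y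
    ≡from⇒to≡ = inverseˡ

Maybe↔⊎⊤ : ∀ {A : Set} → Maybe A ↔ (A ⊎ ⊤)
Maybe↔⊎⊤ = mk↔ₛ′ (maybe inj₁ (inj₂ tt)) Sum.[ just , (λ _ → nothing) ]
  (λ { (inj₁ _) → refl ; (inj₂ tt) → refl }) (λ { (just _) → refl ; nothing → refl })

Vtx↔Fin : ∀ {k} → Vtx k ↔ Fin (4 * k + 1)
Vtx↔Fin {k} = ↔-trans Maybe↔⊎⊤ (↔-trans (Fin×Fin↔Fin ⊎-↔ ↔-sym 1↔⊤) (↔-sym +↔⊎))
  where
  Fin×Fin↔Fin : (Fin k × Fin 4) ↔ Fin (4 * k)
  Fin×Fin↔Fin = ↔-trans (×-comm (Fin k) (Fin 4))
    (mk↔ₛ′ (uncurry combine) (remQuot k) (combine-remQuot k) (uncurry remQuot-combine))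

-- Translates and half cycles in (ℤ_N × ℤ_4) ∪ {∞}

module _ {n : ℕ} where
  private
    N : ℕ
    N = suc n

  just-injectiveˡ : ∀ {x y : Fin N} {l m : Fin 4} → just (x , l) ≡ just (y , m) → x ≡ y
  just-injectiveˡ = ,-injectiveˡ ∘ just-injective

  just-injectiveʳ : ∀ {x y : Fin N} {l m : Fin 4} → just (x , l) ≡ just (y , m) → l ≡ m
  just-injectiveʳ = ,-injectiveʳ ∘ just-injective

  shift : Fin N → Vtx N → Vtx N
  shift t = Maybe.map (map₁ (_⊕ t))

  shift-injective : ∀ t → Injective _≡_ _≡_ (shift t)
  shift-injective t {just _} {just _} e =
    cong₂ (λ x l → just (x , l)) (⊕-cancelʳ t (just-injectiveˡ e)) (just-injectiveʳ e)
  shift-injective t {nothing} {nothing} e = refl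

  translate : Fin N → Cycle (Vtx N) N → Cycle (Vtx N) N
  translate t = mapCycle (shift t) (shift-injective t)

  ∑-shift-onto : ∀ x′ r′ y′ s′ x r y s →
    ∑[ t < N ] 𝟙 ((shift t (just (x′ , r′)) ≟ᵛ just (x , r)) ×-dec (shift t (just (y′ , s′)) ≟ᵛ just (y , s)))
      ≡ 𝟙 ((r′ ≟ᶠ r) ×-dec ((s′ ≟ᶠ s) ×-dec ((x′ ⊖ y′) ≟ᶠ (x ⊖ y))))
  ∑-shift-onto x′ r′ y′ s′ x r y s =
    trans (∑-𝟙-unique P? t₀ (λ t (e , _) → ⊕≡⇒≡⊖ (trans (⊕-comm t x′) (just-injectiveˡ e))))
          (𝟙-cong (λ (e₁ , e₂) → just-injectiveʳ e₁ , just-injectiveʳ e₂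
                                 , ⊖-translate x′ y′ t₀ x y (just-injectiveˡ e₁) (just-injectiveˡ e₂))
                  (λ { (refl , refl , e) → cong (λ w → just (w , r′)) x′⊕t₀≡x
                                         , cong (λ w → just (w , s′)) (⊖-translate⁻¹ x′ y′ t₀ x y x′⊕t₀≡x e) })
                  (P? t₀) _)
    where
    P? : ∀ t → Dec (shift t (just (x′ , r′)) ≡ just (x , r) × shift t (just (y′ , s′)) ≡ just (y , s))
    P? t = (shift t (just (x′ , r′)) ≟ᵛ just (x , r)) ×-dec (shift t (just (y′ , s′)) ≟ᵛ just (y , s))
    t₀ : Fin N
    t₀ = x ⊖ x′
    x′⊕t₀≡x : x′ ⊕ t₀ ≡ x
    x′⊕t₀≡x = x⊕[y⊖x]≡y x′ x

  mult-if : ∀ {a b} {A : Set a} {B : Set b} (p : Dec A) (q : Dec B) (w z : Fin N) →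
    mult z (if does p ∧ does q then w ∷ [] else []) ≡ 𝟙 (p ×-dec (q ×-dec (w ≟ᶠ z)))
  mult-if (yes _) (yes _) w z with w ≟ᶠ z
  ... | yes _ = refl
  ... | no _  = refl
  mult-if (yes _) (no _) w z = refl
  mult-if (no _)  q      w z = refl

  mult-contrib : ∀ x′ r′ y′ s′ r s z → mult z (contrib r s (just (x′ , r′) , just (y′ , s′)))
    ≡ 𝟙 ((r′ ≟ᶠ r) ×-dec ((s′ ≟ᶠ s) ×-dec ((x′ ⊖ y′) ≟ᶠ z)))
      + 𝟙 ((r′ ≟ᶠ s) ×-dec ((s′ ≟ᶠ r) ×-dec ((y′ ⊖ x′) ≟ᶠ z)))
  mult-contrib x′ r′ y′ s′ r s z =
    trans (count-++ (_≟ᶠ z) (if does (r′ ≟ᶠ r) ∧ does (s′ ≟ᶠ s) then (x′ ⊖ y′) ∷ [] else []) _)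
          (cong₂ _+_ (mult-if (r′ ≟ᶠ r) (s′ ≟ᶠ s) (x′ ⊖ y′) z)
                     (mult-if (r′ ≟ᶠ s) (s′ ≟ᶠ r) (y′ ⊖ x′) z))

  ∑-shift-edge : ∀ u w x r y s → just (x , r) ≢ just (y , s) →
    ∑[ t < N ] 𝟙 (sameEdge? _≟ᵛ_ (shift t u , shift t w) (just (x , r) , just (y , s)))
      ≡ mult (x ⊖ y) (contrib r s (u , w))
  ∑-shift-edge (just (x′ , r′)) (just (y′ , s′)) x r y s U≢W = begin
    ∑[ t < N ] 𝟙 (A? t ⊎-dec B? t)
      ≡⟨ sum-cong-≗ (λ t → 𝟙-⊎ (λ (a , b) → U≢W (trans (sym (proj₁ a)) (proj₁ b))) (A? t) (B? t)) ⟩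
    ∑[ t < N ] (𝟙 (A? t) + 𝟙 (B? t))      ≡⟨ ∑-distrib-+ (λ t → 𝟙 (A? t)) (λ t → 𝟙 (B? t)) ⟩
    ∑[ t < N ] 𝟙 (A? t) + ∑[ t < N ] 𝟙 (B? t)
      ≡⟨ cong₂ _+_ (∑-shift-onto x′ r′ y′ s′ x r y s)
           (trans (sum-cong-≗ (λ t → 𝟙-×-comm (shift t u ≟ᵛ W) (shift t w ≟ᵛ U)))
             (trans (∑-shift-onto y′ s′ x′ r′ x r y s)
               (𝟙-cong (λ (a , b , c) → b , a , c) (λ (a , b , c) → b , a , c) _ _))) ⟩
    𝟙 ((r′ ≟ᶠ r) ×-dec ((s′ ≟ᶠ s) ×-dec ((x′ ⊖ y′) ≟ᶠ (x ⊖ y))))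
      + 𝟙 ((r′ ≟ᶠ s) ×-dec ((s′ ≟ᶠ r) ×-dec ((y′ ⊖ x′) ≟ᶠ (x ⊖ y))))
                                          ≡⟨ mult-contrib x′ r′ y′ s′ r s (x ⊖ y) ⟨
    mult (x ⊖ y) (contrib r s (u , w))    ∎
    where
    open ≡-Reasoning
    u w U W : Vtx N
    u = just (x′ , r′)
    w = just (y′ , s′)
    U = just (x , r)
    W = just (y , s)
    A? : ∀ t → Dec (shift t u ≡ U × shift t w ≡ W)
    B? : ∀ t → Dec (shift t u ≡ W × shift t w ≡ U)
    A? t = (shift t u ≟ᵛ U) ×-dec (shift t w ≟ᵛ W)
    B? t = (shift t u ≟ᵛ W) ×-dec (shift t w ≟ᵛ U)
  ∑-shift-edge u@(just _) nothing x r y s _ =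
    ∑-zero (λ t → 𝟙 (sameEdge? _≟ᵛ_ (shift t u , nothing) (just (x , r) , just (y , s))))
      (λ t → 𝟙-no (λ { (inj₁ (_ , ())) ; (inj₂ (_ , ())) }) _)
  ∑-shift-edge nothing w x r y s _ =
    ∑-zero {N} (λ t → 𝟙 (SE? t)) (λ t → 𝟙-no (λ { (inj₁ (() , _)) ; (inj₂ (() , _)) }) (SE? t))
    where
    SE? : ∀ t → Dec (SameEdge (nothing , shift t w) (just (x , r) , just (y , s)))
    SE? t = sameEdge? _≟ᵛ_ (nothing , shift t w) (just (x , r) , just (y , s))

  atLevel : Fin 4 → Vtx N → ℕ
  atLevel s (just (_ , l)) = 𝟙 (l ≟ᶠ s)
  atLevel s nothing        = 0

  arcFrom∞ : Fin 4 → Vtx N → Vtx N → ℕ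
  arcFrom∞ s nothing  w = atLevel s w
  arcFrom∞ s (just _) w = 0

  ∑-shift-edge-∞ : ∀ u w y s →
    ∑[ t < N ] 𝟙 (sameEdge? _≟ᵛ_ (shift t u , shift t w) (∞ , just (y , s))) ≡ arcFrom∞ s u w + arcFrom∞ s w u
  ∑-shift-edge-∞ nothing (just (y′ , l)) y s = begin
    ∑[ t < N ] 𝟙 (SE? t)
      ≡⟨ ∑-𝟙-unique SE? (y ⊖ y′) (λ { t (inj₁ (_ , e)) → ⊕≡⇒≡⊖ (trans (⊕-comm t y′) (just-injectiveˡ e))
                                    ; t (inj₂ (() , _)) }) ⟩
    𝟙 (SE? (y ⊖ y′))        ≡⟨ 𝟙-cong (λ { (inj₁ (_ , e)) → just-injectiveʳ e ; (inj₂ (() , _)) })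
                                      (λ { refl → inj₁ (refl , cong (λ x → just (x , l)) (x⊕[y⊖x]≡y y′ y)) })
                                      (SE? (y ⊖ y′)) (l ≟ᶠ s) ⟩
    𝟙 (l ≟ᶠ s)              ≡⟨ +-identityʳ _ ⟨
    𝟙 (l ≟ᶠ s) + 0          ∎
    where
    open ≡-Reasoning
    SE? : ∀ t → Dec (SameEdge (nothing , just (y′ ⊕ t , l)) (nothing , just (y , s)))
    SE? t = sameEdge? _≟ᵛ_ (nothing , just (y′ ⊕ t , l)) (nothing , just (y , s))
  ∑-shift-edge-∞ (just (x′ , l)) nothing y s =
    trans (sum-cong-≗ (λ t → 𝟙-sameEdge-flip _≟ᵛ_ (just (x′ ⊕ t , l)) nothing ∞ (just (y , s))))
          (trans (∑-shift-edge-∞ nothing (just (x′ , l)) y s) (+-identityʳ _))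
  ∑-shift-edge-∞ nothing nothing y s =
    ∑-zero {N} (λ t → 𝟙 (SE? t)) (λ t → 𝟙-no (λ { (inj₁ (_ , ())) ; (inj₂ (() , _)) }) (SE? t))
    where
    SE? : ∀ t → Dec (SameEdge (nothing , nothing) (nothing , just (y , s)))
    SE? t = sameEdge? _≟ᵛ_ (nothing , nothing) (nothing , just (y , s))
  ∑-shift-edge-∞ (just (x′ , r′)) (just (y′ , s′)) y s =
    ∑-zero {N} (λ t → 𝟙 (SE? t)) (λ t → 𝟙-no (λ { (inj₁ (() , _)) ; (inj₂ (_ , ())) }) (SE? t))
    where
    SE? : ∀ t → Dec (SameEdge (just (x′ ⊕ t , r′) , just (y′ ⊕ t , s′)) (nothing , just (y , s)))
    SE? t = sameEdge? _≟ᵛ_ (just (x′ ⊕ t , r′) , just (y′ ⊕ t , s′)) (nothing , just (y , s))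

  translatesCount : FourCycles N → Vtx N → Vtx N → ℕ
  translatesCount F u w = ∑[ t < N ] ∑[ j < 4 ] edgeCount _≟ᵛ_ (translate t (cyc F j)) u w

  module _ (F : FourCycles N) where
    private
      X : Fin 4 → Fin N → Vtx N
      X j = verts (cyc F j)

    translatesCount-byEdge : ∀ u w → translatesCount F u w
      ≡ ∑[ j < 4 ] ∑[ i < N ] ∑[ t < N ] 𝟙 (sameEdge? _≟ᵛ_ (shift t (X j i) , shift t (X j (next i))) (u , w))
    translatesCount-byEdge u w =
      trans (∑-comm (λ t j → edgeCount _≟ᵛ_ (translate t (cyc F j)) u w))
            (sum-cong-≗ λ j → ∑-comm (λ t i → 𝟙 (sameEdge? _≟ᵛ_ (shift t (X j i) , shift t (X j (next i))) (u , w))))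

    mult-Δ : ∀ r s z → mult z (Δ r s F) ≡ ∑[ j < 4 ] ∑[ i < N ] mult z (contrib r s (X j i , X j (next i)))
    mult-Δ r s z = begin
      mult z (concatMap (contrib r s) (concatMap (cycleEdges ∘ cyc F) (allFin 4)))
        ≡⟨ cong (mult z) (concatMap-concatMap (contrib r s) (cycleEdges ∘ cyc F) (allFin 4)) ⟩
      mult z (concatMap (concatMap (contrib r s) ∘ cycleEdges ∘ cyc F) (allFin 4))
        ≡⟨ count-concatMap-tabulate (_≟ᶠ z) (concatMap (contrib r s) ∘ cycleEdges ∘ cyc F) (λ j → j) ⟩
      ∑[ j < 4 ] mult z (concatMap (contrib r s) (cycleEdges (cyc F j)))
        ≡⟨ sum-cong-≗ (λ j → cong (mult z) (concatMap-map (contrib r s) (edge j) (allFin N))) ⟩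
      ∑[ j < 4 ] mult z (concatMap (contrib r s ∘ edge j) (allFin N))
        ≡⟨ sum-cong-≗ (λ j → count-concatMap-tabulate (_≟ᶠ z) (contrib r s ∘ edge j) (λ i → i)) ⟩
      ∑[ j < 4 ] ∑[ i < N ] mult z (contrib r s (X j i , X j (next i)))
        ∎
      where
      open ≡-Reasoning
      edge : Fin 4 → Fin N → Vtx N × Vtx N
      edge j i = X j i , X j (next i)

    translatesCount-finite : ∀ x r y s → just (x , r) ≢ just (y , s) →
      translatesCount F (just (x , r)) (just (y , s)) ≡ mult (x ⊖ y) (Δ r s F)
    translatesCount-finite x r y s U≢W =
      trans (translatesCount-byEdge (just (x , r)) (just (y , s)))
        (trans (sum-cong-≗ λ j → sum-cong-≗ λ i → ∑-shift-edge (X j i) (X j (next i)) x r y s U≢W)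
               (sym (mult-Δ r s (x ⊖ y))))

    translatesCount-∞ : ∀ y s → translatesCount F ∞ (just (y , s))
      ≡ ∑[ j < 4 ] ∑[ i < N ] (arcFrom∞ s (X j i) (X j (next i)) + arcFrom∞ s (X j (next i)) (X j i))
    translatesCount-∞ y s =
      trans (translatesCount-byEdge ∞ (just (y , s)))
        (sum-cong-≗ λ j → sum-cong-≗ λ i → ∑-shift-edge-∞ (X j i) (X j (next i)) y s)

  halfCycle : (d : Fin N) → Coprime N (toℕ d) → Fin 4 → Cycle (Vtx N) N
  halfCycle d N⊥d q = record
    { verts = λ i → just (i · d , q)
    ; inj   = λ e → ·-injective d N⊥d (just-injectiveˡ e) }

  edgeCount-halfCycle : ∀ (d : Fin N) (N⊥d : Coprime N (toℕ d)) q x y → x ≢ y →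
    edgeCount _≟ᵛ_ (halfCycle d N⊥d q) (just (x , q)) (just (y , q)) ≡ 𝟙 (x ⊕ d ≟ᶠ y) + 𝟙 (y ⊕ d ≟ᶠ x)
  edgeCount-halfCycle d N⊥d q x y x≢y = begin
    ∑[ i < N ] 𝟙 (sameEdge? _≟ᵛ_ (vertex i , vertex (next i)) (U , W))
      ≡⟨ sum-cong-≗ (λ i → cong (λ v → 𝟙 (sameEdge? _≟ᵛ_ (vertex i , just (v , q)) (U , W))) (next-· i d)) ⟩
    ∑[ i < N ] 𝟙 (step? x y i ⊎-dec step? y x i)
      ≡⟨ sum-cong-≗ (λ i → 𝟙-⊎ (λ (a , b) → U≢W (trans (sym (proj₁ a)) (proj₁ b)))
                              (step? x y i) (step? y x i)) ⟩
    ∑[ i < N ] (𝟙 (step? x y i) + 𝟙 (step? y x i))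
      ≡⟨ ∑-distrib-+ (𝟙 ∘ step? x y) (𝟙 ∘ step? y x) ⟩
    ∑[ i < N ] 𝟙 (step? x y i) + ∑[ i < N ] 𝟙 (step? y x i)
      ≡⟨ cong₂ _+_ (∑-step x y) (∑-step y x) ⟩
    𝟙 (x ⊕ d ≟ᶠ y) + 𝟙 (y ⊕ d ≟ᶠ x)
      ∎
    where
    open ≡-Reasoning
    vertex : Fin N → Vtx N
    vertex i = just (i · d , q)
    U W : Vtx N
    U = just (x , q)
    W = just (y , q)
    U≢W : U ≢ W
    U≢W = x≢y ∘ just-injectiveˡ
    step? : ∀ a b i → Dec (vertex i ≡ just (a , q) × just (i · d ⊕ d , q) ≡ just (b , q))
    step? a b i = (vertex i ≟ᵛ just (a , q)) ×-dec (just (i · d ⊕ d , q) ≟ᵛ just (b , q))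
    ∑-step : ∀ a b → ∑[ i < N ] 𝟙 (step? a b i) ≡ 𝟙 (a ⊕ d ≟ᶠ b)
    ∑-step a b = trans
      (∑-𝟙-unique (step? a b) i₀ (λ i (e , _) → ·-injective d N⊥d (trans (just-injectiveˡ e) (sym i₀·d≡a))))
      (𝟙-cong (λ (e₁ , e₂) → trans (cong (_⊕ d) (sym (just-injectiveˡ e₁))) (just-injectiveˡ e₂))
              (λ e → cong (λ v → just (v , q)) i₀·d≡a , cong (λ v → just (v , q)) (trans (cong (_⊕ d) i₀·d≡a) e))
              (step? a b i₀) (a ⊕ d ≟ᶠ b))
      where
      i₀ : Fin N
      i₀ = proj₁ (injective⇒surjective (_· d) (·-injective d N⊥d) a)
      i₀·d≡a : i₀ · d ≡ a
      i₀·d≡a = proj₂ (injective⇒surjective (_· d) (·-injective d N⊥d) a)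

-- The neighbours of ∞

covering-levels-once : ∀ l₁ l₂ l₃ l₄ → (∀ j → j ≡ l₁ ⊎ j ≡ l₂ ⊎ j ≡ l₃ ⊎ j ≡ l₄) →
  ∀ s → 𝟙 (l₁ ≟ᶠ s) + 𝟙 (l₂ ≟ᶠ s) + (𝟙 (l₃ ≟ᶠ s) + 𝟙 (l₄ ≟ᶠ s)) ≡ 1
covering-levels-once = toWitness {a? = all? {4} λ l₁ → all? {4} λ l₂ → all? {4} λ l₃ → all? {4} λ l₄ →
  all? (λ j → (j ≟ᶠ l₁) ⊎-dec (j ≟ᶠ l₂) ⊎-dec (j ≟ᶠ l₃) ⊎-dec (j ≟ᶠ l₄)) →-dec
  all? (λ s → (𝟙 (l₁ ≟ᶠ s) + 𝟙 (l₂ ≟ᶠ s) + (𝟙 (l₃ ≟ᶠ s) + 𝟙 (l₄ ≟ᶠ s))) ℕ.≟ 1)} tt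

-- ∞ has no level: fzero is a junk value, only ever read off finite vertices.
level : ∀ {k} → Vtx k → Fin 4
level (just (_ , l)) = l
level nothing        = fzero

module ∞-Neighbours {n} (1≤n : 1 ≤ n) (F : FourCycles (suc n)) {j₀ i₀} (∞-at : verts (cyc F j₀) i₀ ≡ ∞) where
  private
    N : ℕ
    N = suc n
    X : Fin 4 → Fin N → Vtx N
    X j = verts (cyc F j)

  ∞-unique : ∀ j i → X j i ≡ ∞ → j ≡ j₀ × i ≡ i₀
  ∞-unique j i e with j ≟ᶠ j₀
  ... | yes refl = refl , inj (cyc F j₀) (trans e (sym ∞-at))
  ... | no j≢j₀  = contradiction (trans e (sym ∞-at)) (disjoint F j j₀ j≢j₀ i i₀)

  prev : Fin N
  prev = i₀ ⊖ one

  next-prev : next prev ≡ i₀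
  next-prev = trans (next≡⊕one prev) (x⊖y⊕y≡x i₀ one)

  next≡i₀⇒≡prev : ∀ i → next i ≡ i₀ → i ≡ prev
  next≡i₀⇒≡prev i e = ⊕≡⇒≡⊖ (trans (sym (next≡⊕one i)) e)

  after before : Vtx N
  after  = X j₀ (next i₀)
  before = X j₀ prev

  after≢∞ : after ≢ ∞
  after≢∞ e = next≢id 1≤n i₀ (proj₂ (∞-unique j₀ (next i₀) e))

  before≢∞ : before ≢ ∞
  before≢∞ e = next≢id 1≤n i₀ (trans (cong next (sym (proj₂ (∞-unique j₀ prev e)))) next-prev)

  translatesCount-∞-levels : ∀ y s →
    translatesCount F ∞ (just (y , s)) ≡ 𝟙 (level after ≟ᶠ s) + 𝟙 (level before ≟ᶠ s)
  translatesCount-∞-levels y s = begin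
    translatesCount F ∞ (just (y , s))
      ≡⟨ translatesCount-∞ F y s ⟩
    ∑[ j < 4 ] ∑[ i < N ] (out j i + into j i)
      ≡⟨ trans (sum-cong-≗ λ j → ∑-distrib-+ (out j) (into j))
               (∑-distrib-+ (λ j → ∑[ i < N ] out j i) (λ j → ∑[ i < N ] into j i)) ⟩
    ∑[ j < 4 ] ∑[ i < N ] out j i + ∑[ j < 4 ] ∑[ i < N ] into j i
      ≡⟨ cong₂ _+_ (∑∑-single out j₀ i₀ (λ j i ¬at → arcFrom∞-finite (¬at ∘ ∞-unique j i)))
                   (∑∑-single into j₀ prev (λ j i ¬at → arcFrom∞-finite λ e → ¬at (into-at e))) ⟩
    out j₀ i₀ + into j₀ prev
      ≡⟨ cong₂ _+_ (cong (λ v → arcFrom∞ s v after) ∞-at)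
                   (cong (λ v → arcFrom∞ s v before) (trans (cong (X j₀) next-prev) ∞-at)) ⟩
    atLevel s after + atLevel s before
      ≡⟨ cong₂ _+_ (atLevel-level after≢∞) (atLevel-level before≢∞) ⟩
    𝟙 (level after ≟ᶠ s) + 𝟙 (level before ≟ᶠ s)
      ∎
    where
    open ≡-Reasoning
    out into : Fin 4 → Fin N → ℕ
    out  j i = arcFrom∞ s (X j i) (X j (next i))
    into j i = arcFrom∞ s (X j (next i)) (X j i)
    arcFrom∞-finite : ∀ {u w} → u ≢ ∞ → arcFrom∞ s u w ≡ 0
    arcFrom∞-finite {just _}  _   = refl
    arcFrom∞-finite {nothing} u≢∞ = contradiction refl u≢∞
    atLevel-level : ∀ {u} → u ≢ ∞ → atLevel s u ≡ 𝟙 (level u ≟ᶠ s)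
    atLevel-level {just _}  _   = refl
    atLevel-level {nothing} u≢∞ = contradiction refl u≢∞
    into-at : ∀ {j i} → X j (next i) ≡ ∞ → j ≡ j₀ × i ≡ prev
    into-at {j} {i} e with ∞-unique j (next i) e
    ... | j≡j₀ , next≡i₀ = j≡j₀ , next≡i₀⇒≡prev i next≡i₀

  ∞-edge-level : ∀ x l → IsEdge F ∞ (just (x , l)) → l ≡ level after ⊎ l ≡ level before
  ∞-edge-level x l (j , i , inj₁ (at∞ , e)) with ∞-unique j i at∞
  ... | refl , refl = inj₁ (cong level (sym e))
  ∞-edge-level x l (j , i , inj₂ (e , at∞)) with ∞-unique j (next i) at∞
  ... | refl , next≡i₀ = inj₂ (cong level (trans (sym e) (cong (X j₀) (next≡i₀⇒≡prev i next≡i₀))))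

-- The ARCS developed from F₁ and F₂

module FromStarter {n : ℕ} (2≤n : 2 ≤ n) (F₁ F₂ : FourCycles (suc n))
  (∞∈F₁ : InV F₁ ∞) (∞∈F₂ : InV F₂ ∞)
  (∞-levels : ∀ j → ∃[ x ] (IsEdge F₁ ∞ (just (x , j)) ⊎ IsEdge F₂ ∞ (just (x , j))))
  (Δ-low : ∀ p → toℕ p ≤ 1 → MSetEq (Δ₂ p p F₁ F₂) (λ z → ¬ IsZero z))
  (Δ-high : ∀ q → 2 ≤ toℕ q → ∃[ d ] (Coprime (toℕ d) (suc n)
     × MSetEq (Δ₂ q q F₁ F₂) (λ z → ¬ IsZero z × z ≢ d × z ≢ ⊖ d)))
  (Δ-mixed : ∀ r s → r ≢ s → MSetEq (Δ₂ r s F₁ F₂) (λ _ → ⊤))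
  where

  private
    N : ℕ
    N = suc n
    V : Set
    V = Vtx N

    high : ∀ h → ∃[ d ] (Coprime (toℕ d) N
      × MSetEq (Δ₂ (2 ↑ʳ h) (2 ↑ʳ h) F₁ F₂) (λ z → ¬ IsZero z × z ≢ d × z ≢ ⊖ d))
    high h = Δ-high (2 ↑ʳ h) (s≤s (s≤s z≤n))

  d : Fin 2 → Fin N
  d h = proj₁ (high h)

  d-unit : ∀ h → Coprime N (toℕ (d h))
  d-unit h = Coprime.sym (proj₁ (proj₂ (high h)))

  half : Fin 2 → Cycle V N
  half h = halfCycle (d h) (d-unit h) (2 ↑ʳ h)

  translates : Fin (N + N) → Fin 4 → Cycle V N
  translates = (λ t j → translate t (cyc F₁ j)) ++ᵛ (λ t j → translate t (cyc F₂ j))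

  translatesCount₂ : V → V → ℕ
  translatesCount₂ u w = translatesCount F₁ u w + translatesCount F₂ u w

  halfCount : V → V → ℕ
  halfCount u w = ∑[ h < 2 ] edgeCount _≟ᵛ_ (half h) u w

  cover : V → V → ℕ
  cover u w = translatesCount₂ u w + halfCount u w

  ∑-translates : ∀ u w →
    ∑[ c < N + N ] ∑[ j < 4 ] edgeCount _≟ᵛ_ (translates c j) u w ≡ translatesCount₂ u w
  ∑-translates u w = trans (sum-cong-≗ split) (∑-++ (classCount F₁) (classCount F₂))
    where
    classCount : FourCycles N → Fin N → ℕ
    classCount F t = ∑[ j < 4 ] edgeCount _≟ᵛ_ (translate t (cyc F j)) u w
    split : ∀ c → ∑[ j < 4 ] edgeCount _≟ᵛ_ (translates c j) u w ≡ (classCount F₁ ++ᵛ classCount F₂) c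
    split c with splitAt N c
    ... | inj₁ _ = refl
    ... | inj₂ _ = refl

  half-offLevel : ∀ h x l w → 2 ↑ʳ h ≢ l → edgeCount _≟ᵛ_ (half h) (just (x , l)) w ≡ 0
  half-offLevel h x l w q≢l = edgeCount-absent _≟ᵛ_ (half h) (just (x , l)) w (λ i e → q≢l (just-injectiveʳ e))

  halfCount-off : ∀ x r w → (∀ h → 2 ↑ʳ h ≢ r) → halfCount (just (x , r)) w ≡ 0
  halfCount-off x r w off =
    ∑-zero (λ h → edgeCount _≟ᵛ_ (half h) (just (x , r)) w) λ h → half-offLevel h x r w (off h)

  halfCount-∞ : ∀ w → halfCount ∞ w ≡ 0
  halfCount-∞ w = ∑-zero (λ h → edgeCount _≟ᵛ_ (half h) ∞ w) λ h → edgeCount-absent _≟ᵛ_ (half h) ∞ w (λ i ())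

  halfCount-mixed : ∀ x r y s → r ≢ s → halfCount (just (x , r)) (just (y , s)) ≡ 0
  halfCount-mixed x r y s r≢s =
    ∑-zero (λ h → edgeCount _≟ᵛ_ (half h) U W) λ h → off-level h (2 ↑ʳ h ≟ᶠ r)
    where
    U W : V
    U = just (x , r)
    W = just (y , s)
    off-level : ∀ h → Dec (2 ↑ʳ h ≡ r) → edgeCount _≟ᵛ_ (half h) U W ≡ 0
    off-level h (yes refl) = trans (edgeCount-comm _≟ᵛ_ (half h) U W) (half-offLevel h y s U r≢s)
    off-level h (no q≢r)   = half-offLevel h x r W q≢r

  halfCount-on : ∀ h₀ x y → x ≢ y →
    halfCount (just (x , 2 ↑ʳ h₀)) (just (y , 2 ↑ʳ h₀)) ≡ 𝟙 (x ⊕ d h₀ ≟ᶠ y) + 𝟙 (y ⊕ d h₀ ≟ᶠ x)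
  halfCount-on h₀ x y x≢y = trans
    (∑-single (λ h → edgeCount _≟ᵛ_ (half h) U W) h₀ λ h h≢h₀ →
       half-offLevel h x (2 ↑ʳ h₀) W (h≢h₀ ∘ ↑ʳ-injective 2 h h₀))
    (edgeCount-halfCycle (d h₀) (d-unit h₀) (2 ↑ʳ h₀) x y x≢y)
    where
    U W : V
    U = just (x , 2 ↑ʳ h₀)
    W = just (y , 2 ↑ʳ h₀)

  translatesCount₂-finite : ∀ x r y s → just (x , r) ≢ just (y , s) →
    translatesCount₂ (just (x , r)) (just (y , s)) ≡ mult (x ⊖ y) (Δ₂ r s F₁ F₂)
  translatesCount₂-finite x r y s U≢W = trans
    (cong₂ _+_ (translatesCount-finite F₁ x r y s U≢W) (translatesCount-finite F₂ x r y s U≢W))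
    (sym (count-++ (_≟ᶠ (x ⊖ y)) (Δ r s F₁) (Δ r s F₂)))

  cover-mixedLevels : ∀ x r y s → r ≢ s → cover (just (x , r)) (just (y , s)) ≡ 1
  cover-mixedLevels x r y s r≢s = trans
    (cong₂ _+_ (translatesCount₂-finite x r y s (r≢s ∘ just-injectiveʳ)) (halfCount-mixed x r y s r≢s))
    (cong (_+ 0) (proj₁ (Δ-mixed r s r≢s (x ⊖ y)) tt))

  cover-sameLevel : ∀ x y r → x ≢ y → cover (just (x , r)) (just (y , r)) ≡ 1
  cover-sameLevel x y r x≢y = trans
    (cong (_+ halfCount (just (x , r)) (just (y , r))) (translatesCount₂-finite x r y r (x≢y ∘ just-injectiveˡ)))
    (count≡1 r)
    where
    count≡1 : ∀ r → mult (x ⊖ y) (Δ₂ r r F₁ F₂) + halfCount (just (x , r)) (just (y , r)) ≡ 1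
    count≡1 fzero = cong₂ _+_ (proj₁ (Δ-low fzero z≤n (x ⊖ y)) (≢⇒⊖-nonzero x≢y))
                              (halfCount-off x fzero (just (y , fzero)) λ h ())
    count≡1 (fsuc fzero) = cong₂ _+_ (proj₁ (Δ-low (fsuc fzero) (s≤s z≤n) (x ⊖ y)) (≢⇒⊖-nonzero x≢y))
                                     (halfCount-off x (fsuc fzero) (just (y , fsuc fzero)) λ h ())
    count≡1 (fsuc (fsuc h)) = trans
      (cong (mult (x ⊖ y) (Δ₂ (2 ↑ʳ h) (2 ↑ʳ h) F₁ F₂) +_) (halfCount-on h x y x≢y))
      (mult-with-halfEdges (d h) (d≢⊖d 2≤n (d h) (d-unit h)) (Δ₂ (2 ↑ʳ h) (2 ↑ʳ h) F₁ F₂)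
                           (proj₂ (proj₂ (high h))) x y x≢y)

  private
    1≤n : 1 ≤ n
    1≤n = ≤-trans (s≤s z≤n) 2≤n
    module ∞₁ = ∞-Neighbours 1≤n F₁ (proj₂ (proj₂ ∞∈F₁))
    module ∞₂ = ∞-Neighbours 1≤n F₂ (proj₂ (proj₂ ∞∈F₂))

  ∞-neighbour-levels-cover :
    ∀ j → j ≡ level ∞₁.after ⊎ j ≡ level ∞₁.before ⊎ j ≡ level ∞₂.after ⊎ j ≡ level ∞₂.before
  ∞-neighbour-levels-cover j with ∞-levels j
  ... | x , inj₁ e = Sum.map₂ inj₁ (∞₁.∞-edge-level x j e)
  ... | x , inj₂ e = inj₂ (inj₂ (∞₂.∞-edge-level x j e))

  cover-∞ : ∀ y s → cover ∞ (just (y , s)) ≡ 1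
  cover-∞ y s = begin
    cover ∞ (just (y , s))
      ≡⟨ cong₂ _+_ (cong₂ _+_ (∞₁.translatesCount-∞-levels y s) (∞₂.translatesCount-∞-levels y s))
                   (halfCount-∞ (just (y , s))) ⟩
    𝟙 (a₁ ≟ᶠ s) + 𝟙 (b₁ ≟ᶠ s) + (𝟙 (a₂ ≟ᶠ s) + 𝟙 (b₂ ≟ᶠ s)) + 0
      ≡⟨ +-identityʳ _ ⟩
    𝟙 (a₁ ≟ᶠ s) + 𝟙 (b₁ ≟ᶠ s) + (𝟙 (a₂ ≟ᶠ s) + 𝟙 (b₂ ≟ᶠ s))
      ≡⟨ covering-levels-once a₁ b₁ a₂ b₂ ∞-neighbour-levels-cover s ⟩
    1 ∎
    where
    open ≡-Reasoning
    a₁ b₁ a₂ b₂ : Fin 4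
    a₁ = level ∞₁.after
    b₁ = level ∞₁.before
    a₂ = level ∞₂.after
    b₂ = level ∞₂.before

  cover-comm : ∀ u w → cover u w ≡ cover w u
  cover-comm u w = cong₂ _+_ (cong₂ _+_ (translatesCount-comm F₁) (translatesCount-comm F₂))
    (sum-cong-≗ λ h → edgeCount-comm _≟ᵛ_ (half h) u w)
    where
    translatesCount-comm : ∀ F → translatesCount F u w ≡ translatesCount F w u
    translatesCount-comm F = sum-cong-≗ λ t → sum-cong-≗ λ j → edgeCount-comm _≟ᵛ_ (translate t (cyc F j)) u w

  cover≡1 : ∀ u w → u ≢ w → cover u w ≡ 1
  cover≡1 (just (x , r)) (just (y , s)) u≢w with r ≟ᶠ s
  ... | no r≢s   = cover-mixedLevels x r y s r≢s
  ... | yes refl = cover-sameLevel x y r (u≢w ∘ cong (λ v → just (v , r)))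
  cover≡1 nothing        (just (y , s)) _   = cover-∞ y s
  cover≡1 (just (x , r)) nothing        _   = trans (cover-comm _ ∞) (cover-∞ x r)
  cover≡1 nothing        nothing        u≢w = contradiction refl u≢w

  translates-disjoint : ∀ c → PairwiseVDisjoint (translates c)
  translates-disjoint c with splitAt N c
  ... | inj₁ t = mapCycle-pairwiseVDisjoint (shift t) (shift-injective t) (cyc F₁) (disjoint F₁)
  ... | inj₂ t = mapCycle-pairwiseVDisjoint (shift t) (shift-injective t) (cyc F₂) (disjoint F₂)

  half-disjoint : PairwiseVDisjoint half
  half-disjoint a b a≢b i j e = a≢b (↑ʳ-injective 2 a b (just-injectiveʳ e))

  private
    open Inverse (Vtx↔Fin {N}) using (to; from; strictlyInverseˡ)

    encode : Cycle V N → Cycle (Fin (4 * N + 1)) N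
    encode = mapCycle to (to-injective Vtx↔Fin)

    from-injective : ∀ {a b} → from a ≡ from b → a ≡ b
    from-injective {a} {b} e = trans (sym (strictlyInverseˡ a)) (trans (cong to e) (strictlyInverseˡ b))

    [m+m]*2≡4*m : ∀ m → (m + m) * 2 ≡ 4 * m
    [m+m]*2≡4*m = solve-∀

    4*N+1∸1≡4*N : 4 * N + 1 ∸ 1 ≡ 4 * N
    4*N+1∸1≡4*N = m+n∸n≡m (4 * N) 1

  systemCycles : List (Cycle (Fin (4 * N + 1)) N)
  systemCycles = concatMap (λ c → map (encode ∘ translates c) (allFin 4)) (allFin (N + N)) ++ map (encode ∘ half) (allFin 2)

  cycleSystem : IsCycleSystem (4 * N + 1) N systemCycles
  cycleSystem a b a≢b = begin
    edgeMult _≟ᶠ_ systemCycles a b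
      ≡⟨ edgeMult-classes _≟ᶠ_ (λ c → encode ∘ translates c) (encode ∘ half) a b ⟩
    ∑[ c < N + N ] ∑[ j < 4 ] edgeCount _≟ᶠ_ (encode (translates c j)) a b
      + ∑[ h < 2 ] edgeCount _≟ᶠ_ (encode (half h)) a b
      ≡⟨ cong₂ _+_ (sum-cong-≗ λ c → sum-cong-≗ λ j → edgeCount-↔ Vtx↔Fin _≟ᵛ_ _≟ᶠ_ (translates c j) a b)
                   (sum-cong-≗ λ h → edgeCount-↔ Vtx↔Fin _≟ᵛ_ _≟ᶠ_ (half h) a b) ⟩
    ∑[ c < N + N ] ∑[ j < 4 ] edgeCount _≟ᵛ_ (translates c j) (from a) (from b) + halfCount (from a) (from b)
      ≡⟨ cong (_+ halfCount (from a) (from b)) (∑-translates (from a) (from b)) ⟩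
    cover (from a) (from b)
      ≡⟨ cover≡1 (from a) (from b) (a≢b ∘ from-injective) ⟩
    1 ∎
    where open ≡-Reasoning

  arcs : ARCS N (4 * N + 1)
  arcs = record
    { nA = 4 ; nH = 2 ; nC = N + N
    ; nA-def = sym 4*N+1∸1≡4*N
    ; nH-def = trans (sym (*-assoc 2 2 N)) (sym 4*N+1∸1≡4*N)
    ; nC-def = trans ([m+m]*2≡4*m N) (sym 4*N+1∸1≡4*N)
    ; apc = λ c → encode ∘ translates c
    ; hpc = encode ∘ half
    ; apc-almostParallel = λ c → mapCycle-pairwiseVDisjoint to (to-injective Vtx↔Fin) (translates c) (translates-disjoint c)
    ; hpc-halfParallel = mapCycle-pairwiseVDisjoint to (to-injective Vtx↔Fin) half half-disjoint
    ; cycleSystem = cycleSystem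
    }

lemma2p1 : (k : ℕ) → 3 ≤ k → (F₁ F₂ : FourCycles k)
    → (∃[ a₁ ] ∃[ b₁ ] ∀ x → (InV F₁ x → x ≢ just (a₁ , b₁)) × (x ≢ just (a₁ , b₁) → InV F₁ x))
    → (∃[ a₂ ] ∃[ b₂ ] ∀ x → (InV F₂ x → x ≢ just (a₂ , b₂)) × (x ≢ just (a₂ , b₂) → InV F₂ x))
    → (∀ (j : Fin 4) → ∃[ x ] (IsEdge F₁ ∞ (just (x , j)) ⊎ IsEdge F₂ ∞ (just (x , j))))
    → (∀ (p : Fin 4) → toℕ p ≤ 1 → MSetEq (Δ₂ p p F₁ F₂) (λ z → ¬ IsZero z))
    → (∀ (q : Fin 4) → 2 ≤ toℕ q → ∃[ d ] (Coprime (toℕ d) k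
         × MSetEq (Δ₂ q q F₁ F₂) (λ z → ¬ IsZero z × z ≢ d × z ≢ ⊖ d)))
    → (∀ (r s : Fin 4) → r ≢ s → MSetEq (Δ₂ r s F₁ F₂) (λ _ → ⊤))
    → ARCS k (4 * k + 1)
lemma2p1 (suc (suc (suc m))) (s≤s (s≤s (s≤s _))) F₁ F₂ (_ , _ , V₁) (_ , _ , V₂) =
  FromStarter.arcs (s≤s (s≤s z≤n)) F₁ F₂ (proj₂ (V₁ ∞) λ ()) (proj₂ (V₂ ∞) λ ())
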